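{- Let $(G,\mathcal{T},(A^\circ,B^\circ),k)$ be a Terminal Separation instance, $\mathcal{T}'$ the set of unresolved pairs, and $\{s,t\}\in\mathcal{T}'$. Let $\mathcal{F}$ be the family of all maximal terminal separations $(A_s,B_t)$ that have minimum cost among terminal separations extending $(A^\circ\cup\{s\},B^\circ\cup\{t\})$, and suppose that every separation in $\mathcal{F}$ resolves no pair of $\mathcal{T}'$ other than $\{s,t\}$. Then there exists a unique maximal terminal separation $(A_s^{\max},B_t^{\min})$ such that $A_s^{\max}\supseteq A_s$ and $B_t^{\min}\subseteq B_t$ for every $(A_s,B_t)\in\mathcal{F}$. Moreover, if $A$ is a set with $A^\circ\cup\{s\}\subseteq A$, $A\cap B^\circ=\emptyset$, $A$ containing no terminal of a pair of $\mathcal{T}'$ other than $s$, and $A\setminus A_s^{\max}\neq\emptyset$, then $d(A)>d(A_s^{\max})$.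
   Context: Graphs may have multiple edges but no loops; $d(X)$ is the number of edges with exactly one endpoint in $X$. A Terminal Separation instance consists of a graph $G$, a set $\mathcal{T}$ of pairwise disjoint pairs of vertices (terminals) each of degree at most one, a terminal separation $(A^\circ,B^\circ)$, and an integer $k$. A terminal separation is a pair $(A,B)$ of disjoint vertex sets such that every pair of $\mathcal{T}$ either has one terminal in $A$ and the other in $B$, or is disjoint from $A\cup B$; $(A',B')$ extends $(A,B)$ if $A\subseteq A'$, $B\subseteq B'$; its cost is $(d(A)+d(B))/2$. A terminal separation is maximal if every other terminal separation extending it has strictly larger cost. A pair is unresolved if it is disjoint from $A^\circ\cup B^\circ$; a separation $(A,B)$ resolves a pair if the pair is contained in $A\cup B$. -}

module Defs where

open import Data.Nat using (ℕ; _+_; _≤_; _<_)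
open import Data.Bool using (Bool; _xor_; _∨_)
open import Data.Fin using (Fin)
open import Data.Fin.Subset using (Subset; _∈_; _∉_; _⊆_; _∪_; _∩_; Empty; ⁅_⁆)
import Data.Vec
open import Data.List using (List; length; filterᵇ) renaming (lookup to lookupL)
open import Data.List.Membership.Propositional using () renaming (_∈_ to _∈L_)
open import Data.List.Relation.Unary.All using (All)
open import Data.Product using (_×_; _,_; Σ; ∃)
open import Data.Sum using (_⊎_)
open import Relation.Binary.PropositionalEquality using (_≡_; _≢_)
open import Relation.Nullary using (¬_)

Edge : ℕ → Set
Edge n = Fin n × Fin n

LoopFree : ∀ {n} → List (Edge n) → Set
LoopFree E = All (λ e → Data.Product.proj₁ e ≢ Data.Product.proj₂ e) E

d : ∀ {n} → List (Edge n) → Subset n → ℕ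
d E X = length (filterᵇ (λ e → Data.Vec.lookup X (Data.Product.proj₁ e) xor Data.Vec.lookup X (Data.Product.proj₂ e)) E)

-- degree of a vertex (number of incident edges; no loops)
deg : ∀ {n} → List (Edge n) → Fin n → ℕ
deg E v = d E ⁅ v ⁆

-- A terminal pair {a,b} is represented as an ordered pair (a , b).
Pair : ℕ → Set
Pair n = Fin n × Fin n

IsTerminal : ∀ {n} → List (Pair n) → Fin n → Set
IsTerminal T v = ∃ λ p → p ∈L T × (Data.Product.proj₁ p ≡ v ⊎ Data.Product.proj₂ p ≡ v)

DisjointPairs : ∀ {n} → Pair n → Pair n → Set
DisjointPairs (a , b) (c , d') = a ≢ c × a ≢ d' × b ≢ c × b ≢ d'

ValidTerminals : ∀ {n} → List (Edge n) → List (Pair n) → Set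
ValidTerminals E T =
  All (λ p → Data.Product.proj₁ p ≢ Data.Product.proj₂ p) T
  × (∀ i j → i ≢ j → DisjointPairs (lookupL T i) (lookupL T j))
  × (∀ v → IsTerminal T v → deg E v ≤ 1)

Disjoint : ∀ {n} → Subset n → Subset n → Set
Disjoint A B = Empty (A ∩ B)

TermSep : ∀ {n} → List (Pair n) → Subset n → Subset n → Set
TermSep T A B = Disjoint A B ×
  (∀ a b → (a , b) ∈L T →
      (a ∈ A × b ∈ B) ⊎ (b ∈ A × a ∈ B) ⊎ (a ∉ A ∪ B × b ∉ A ∪ B))

Extends : ∀ {n} → Subset n → Subset n → Subset n → Subset n → Set
Extends A B A' B' = A ⊆ A' × B ⊆ B'

-- twice the cost (d(A)+d(B))/2; only comparisons of costs are used
cost2 : ∀ {n} → List (Edge n) → Subset n → Subset n → ℕ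
cost2 E A B = d E A + d E B

Maximal : ∀ {n} → List (Edge n) → List (Pair n) → Subset n → Subset n → Set
Maximal E T A B = TermSep T A B ×
  (∀ A' B' → TermSep T A' B' → Extends A B A' B' → ¬ (A' ≡ A × B' ≡ B) →
     cost2 E A B < cost2 E A' B')

Unresolved : ∀ {n} → Subset n → Subset n → Pair n → Set
Unresolved A° B° (a , b) = a ∉ A° ∪ B° × b ∉ A° ∪ B°

Resolves : ∀ {n} → Subset n → Subset n → Pair n → Set
Resolves A B (a , b) = a ∈ A ∪ B × b ∈ A ∪ B

SamePair : ∀ {n} → Pair n → Fin n → Fin n → Set
SamePair (a , b) s t = (a ≡ s × b ≡ t) ⊎ (a ≡ t × b ≡ s)

InF : ∀ {n} → List (Edge n) → List (Pair n) → Subset n → Subset n →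
      Fin n → Fin n → Subset n → Subset n → Set
InF E T A° B° s t A B =
  Maximal E T A B × Extends (A° ∪ ⁅ s ⁆) (B° ∪ ⁅ t ⁆) A B ×
  (∀ A' B' → TermSep T A' B' → Extends (A° ∪ ⁅ s ⁆) (B° ∪ ⁅ t ⁆) A' B' →
     cost2 E A B ≤ cost2 E A' B')

module Submission where

-- Cut functions are submodular and posimodular. Among the minimum-cost extensions
-- of (A° ∪ {s} , B° ∪ {t}) pick one whose first side P is as large as possible and
-- extend it to a maximal one (P , Q). The unresolved pairs other than {s , t} avoid
-- P, Q and every member (A , B) of 𝓕, so the crossings (P ∪ A , Q ∩ B) and
-- (P ∩ A , Q ∪ B) are again extensions and, by submodularity, of minimum cost:
-- the first gives A ⊆ P by the choice of P, the second Q ⊆ B by maximality of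
-- (A , B). The cut bound for A is the same exchange argument, with posimodularity.

open import Defs
open import Data.Bool using (Bool; true; false; _xor_; _∨_; _∧_; not; T)
open import Data.Bool.Properties using (T-∧) renaming (_≟_ to _≟ᵇ_)
open import Data.Empty using (⊥)
open import Data.Integer using (ℤ)
open import Data.Fin using (Fin) renaming (_≟_ to _≟ᶠ_)
open import Data.Fin.Subset using (Subset; _∈_; _∉_; _⊆_; _∪_; _∩_; ∁; ∣_∣; ⁅_⁆)
open import Data.Fin.Subset.Properties
  using ( _∈?_; _⊆?_; nonempty?; anySubset?; ⊆-antisym; ∣p∣≤n; p⊆q⇒∣p∣≤∣q∣; p⊂q⇒∣p∣<∣q∣
        ; x∈⁅x⁆; x∈⁅y⁆⇒x≡y; p⊆p∪q; q⊆p∪q; x∈p∪q⁺; x∈p∪q⁻; p∩q⊆p; p∩q⊆q; x∈p∩q⁺; x∈p∩q⁻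
        ; x∉p⇒x∈∁p; x∈∁p⇒x∉p )
open import Data.List using (List; []; _∷_; length; filterᵇ) renaming (lookup to lookupL)
open import Data.List.Membership.Propositional using () renaming (_∈_ to _∈L_)
import Data.List.Relation.Unary.All as All
import Data.List.Relation.Unary.Any as Any
open import Data.List.Relation.Unary.Any.Properties using (lookup-index)
open import Data.Nat using (ℕ; _+_; _∸_; _≤_; _<_; _≤ᵇ_; z≤n)
open import Data.Nat.Induction using (<-wellFounded)
open import Data.Nat.Properties
open import Algebra.Properties.CommutativeSemigroup +-commutativeSemigroup using (interchange)
open import Data.Product using (_×_; _,_; Σ; ∃; proj₁; proj₂; swap)
open import Data.Sum using (_⊎_; inj₁; inj₂; [_,_]′)
open import Data.Unit using (tt)
open import Data.Vec using (lookup)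
open import Data.Vec.Properties using (lookup-zipWith; lookup-map; ≡-dec)
open import Function using (_∘_; id)
open import Function.Bundles using (Equivalence)
open import Induction.WellFounded using (Acc; acc)
open import Level using (0ℓ)
open import Relation.Binary.PropositionalEquality
  using (_≡_; _≢_; refl; sym; trans; cong; subst; subst₂)
open import Relation.Nullary using (¬_; Dec; yes; no; ¬?; _×-dec_; _⊎-dec_; contradiction)
open import Relation.Nullary.Decidable using (map′)
open import Relation.Unary using (Pred; Decidable)

χ : Bool → ℕ
χ true  = 1
χ false = 0

length-filterᵇ-∷ : ∀ {A : Set} (f : A → Bool) x xs →
  length (filterᵇ f (x ∷ xs)) ≡ χ (f x) + length (filterᵇ f xs)
length-filterᵇ-∷ f x xs with f x
... | true  = refl
... | false = refl

length-filterᵇ-+-mono : ∀ {A : Set} (f g h k : A → Bool) →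
  (∀ x → χ (f x) + χ (g x) ≤ χ (h x) + χ (k x)) → ∀ xs →
  length (filterᵇ f xs) + length (filterᵇ g xs) ≤ length (filterᵇ h xs) + length (filterᵇ k xs)
length-filterᵇ-+-mono f g h k le [] = z≤n
length-filterᵇ-+-mono f g h k le (x ∷ xs)
  rewrite length-filterᵇ-∷ f x xs | length-filterᵇ-∷ g x xs
        | length-filterᵇ-∷ h x xs | length-filterᵇ-∷ k x xs
        | interchange (χ (f x)) (length (filterᵇ f xs)) (χ (g x)) (length (filterᵇ g xs))
        | interchange (χ (h x)) (length (filterᵇ h xs)) (χ (k x)) (length (filterᵇ k xs))
  = +-mono-≤ (le x) (length-filterᵇ-+-mono f g h k le xs)

∀ᵇ : (Bool → Bool) → Bool
∀ᵇ f = f true ∧ f false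

∀ᵇ-sound : ∀ f → T (∀ᵇ f) → ∀ b → T (f b)
∀ᵇ-sound f h true  = proj₁ (Equivalence.to T-∧ h)
∀ᵇ-sound f h false = proj₂ (Equivalence.to T-∧ h)

∀ᵇ⁴ : (Bool → Bool → Bool → Bool → Bool) → Bool
∀ᵇ⁴ f = ∀ᵇ λ x → ∀ᵇ λ x' → ∀ᵇ λ y → ∀ᵇ (f x x' y)

∀ᵇ⁴-sound : ∀ f → T (∀ᵇ⁴ f) → ∀ x x' y y' → T (f x x' y y')
∀ᵇ⁴-sound f h x x' y = ∀ᵇ-sound (f x x' y)
  (∀ᵇ-sound (λ y → ∀ᵇ (f x x' y))
    (∀ᵇ-sound (λ x' → ∀ᵇ λ y → ∀ᵇ (f x x' y))
      (∀ᵇ-sound (λ x → ∀ᵇ λ x' → ∀ᵇ λ y → ∀ᵇ (f x x' y)) h x) x') y)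

cutExchangeᵇ : (φ ψ : Bool → Bool → Bool) → Bool → Bool → Bool → Bool → Bool
cutExchangeᵇ φ ψ x x' y y' =
  (χ (φ x y xor φ x' y') + χ (ψ x y xor ψ x' y')) ≤ᵇ (χ (x xor x') + χ (y xor y'))

-- x, y are the memberships of one endpoint of an edge in two sets X, Y, and x', y'
-- those of the other endpoint; φ and ψ combine X and Y pointwise.
record CutExchange (φ ψ : Bool → Bool → Bool) : Set where
  constructor cutExchange
  field
    bound : ∀ x x' y y' →
      χ (φ x y xor φ x' y') + χ (ψ x y xor ψ x' y') ≤ χ (x xor x') + χ (y xor y')

cutExchange-by-table : ∀ φ ψ → T (∀ᵇ⁴ (cutExchangeᵇ φ ψ)) → CutExchange φ ψ
cutExchange-by-table φ ψ table =
  cutExchange λ x x' y y' → ≤ᵇ⇒≤ _ _ (∀ᵇ⁴-sound (cutExchangeᵇ φ ψ) table x x' y y')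

∨-∧-cutExchange : CutExchange _∨_ _∧_
∨-∧-cutExchange = cutExchange-by-table _∨_ _∧_ tt

∖-cutExchange : CutExchange (λ x y → x ∧ not y) (λ x y → y ∧ not x)
∖-cutExchange = cutExchange-by-table _ _ tt

module _ {n : ℕ} where

  cut : Subset n → Edge n → Bool
  cut X (u , v) = lookup X u xor lookup X v

  d-exchange : ∀ (E : List (Edge n)) {φ ψ} → CutExchange φ ψ → (X Y Z W : Subset n) →
    (∀ i → lookup Z i ≡ φ (lookup X i) (lookup Y i)) →
    (∀ i → lookup W i ≡ ψ (lookup X i) (lookup Y i)) →
    d E Z + d E W ≤ d E X + d E Y
  d-exchange E (cutExchange exchange) X Y Z W Z≗ W≗ =
    length-filterᵇ-+-mono (cut Z) (cut W) (cut X) (cut Y) per-edge E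
    where
    per-edge : ∀ e → χ (cut Z e) + χ (cut W e) ≤ χ (cut X e) + χ (cut Y e)
    per-edge (u , v) rewrite Z≗ u | Z≗ v | W≗ u | W≗ v =
      exchange (lookup X u) (lookup X v) (lookup Y u) (lookup Y v)

  d-submodular : ∀ (E : List (Edge n)) (X Y : Subset n) →
    d E (X ∪ Y) + d E (X ∩ Y) ≤ d E X + d E Y
  d-submodular E X Y =
    d-exchange E ∨-∧-cutExchange X Y (X ∪ Y) (X ∩ Y)
      (λ i → lookup-zipWith _∨_ i X Y) (λ i → lookup-zipWith _∧_ i X Y)

  d-posimodular : ∀ (E : List (Edge n)) (X Y : Subset n) →
    d E (X ∩ ∁ Y) + d E (Y ∩ ∁ X) ≤ d E X + d E Y
  d-posimodular E X Y =
    d-exchange E ∖-cutExchange X Y (X ∩ ∁ Y) (Y ∩ ∁ X) (lookup-∩∁ X Y) (lookup-∩∁ Y X)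
    where
    lookup-∩∁ : ∀ (X Y : Subset n) i → lookup (X ∩ ∁ Y) i ≡ lookup X i ∧ not (lookup Y i)
    lookup-∩∁ X Y i =
      trans (lookup-zipWith _∧_ i X (∁ Y)) (cong (lookup X i ∧_) (lookup-map i not Y))

  cost2-submodular : ∀ (E : List (Edge n)) (A B A' B' : Subset n) →
    cost2 E (A ∪ A') (B ∩ B') + cost2 E (A ∩ A') (B ∪ B') ≤ cost2 E A B + cost2 E A' B'
  cost2-submodular E A B A' B' = begin
    (d E (A ∪ A') + d E (B ∩ B')) + (d E (A ∩ A') + d E (B ∪ B'))
      ≡⟨ interchange (d E (A ∪ A')) _ _ _ ⟩
    (d E (A ∪ A') + d E (A ∩ A')) + (d E (B ∩ B') + d E (B ∪ B'))
      ≡⟨ cong ((d E (A ∪ A') + d E (A ∩ A')) +_) (+-comm (d E (B ∩ B')) _) ⟩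
    (d E (A ∪ A') + d E (A ∩ A')) + (d E (B ∪ B') + d E (B ∩ B'))
      ≤⟨ +-mono-≤ (d-submodular E A A') (d-submodular E B B') ⟩
    (d E A + d E A') + (d E B + d E B')
      ≡⟨ interchange (d E A) _ _ _ ⟩
    (d E A + d E B) + (d E A' + d E B') ∎
    where open ≤-Reasoning

  p⊆q∧∣q∣≤∣p∣⇒p≡q : ∀ {p q : Subset n} → p ⊆ q → ∣ q ∣ ≤ ∣ p ∣ → p ≡ q
  p⊆q∧∣q∣≤∣p∣⇒p≡q {p} {q} p⊆q ∣q∣≤∣p∣ = ⊆-antisym p⊆q q⊆p
    where
    q⊆p : q ⊆ p
    q⊆p {x} x∈q with x ∈? p
    ... | yes x∈p = x∈p
    ... | no  x∉p = contradiction ∣q∣≤∣p∣ (<⇒≱ (p⊂q⇒∣p∣<∣q∣ (p⊆q , x , x∈q , x∉p)))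

  ∣p∪q∣≤∣p∣⇒q⊆p : ∀ {p q : Subset n} → ∣ p ∪ q ∣ ≤ ∣ p ∣ → q ⊆ p
  ∣p∪q∣≤∣p∣⇒q⊆p {p} {q} ∣p∪q∣≤∣p∣ x∈q =
    subst (_ ∈_) (sym (p⊆q∧∣q∣≤∣p∣⇒p≡q (p⊆p∪q q) ∣p∪q∣≤∣p∣)) (q⊆p∪q p q x∈q)

  ⊆-∩ : ∀ {C D D' : Subset n} → C ⊆ D → C ⊆ D' → C ⊆ D ∩ D'
  ⊆-∩ C⊆D C⊆D' x∈C = x∈p∩q⁺ (C⊆D x∈C , C⊆D' x∈C)

  ∉-∪ : ∀ {C D : Subset n} {x} → x ∉ C → x ∉ D → x ∉ C ∪ D
  ∉-∪ {C} {D} x∉C x∉D x∈C∪D = [ x∉C , x∉D ]′ (x∈p∪q⁻ C D x∈C∪D)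

  disjoint : ∀ {C D : Subset n} → (∀ {x} → x ∈ C → x ∈ D → ⊥) → Disjoint C D
  disjoint {C} {D} apart (x , x∈C∩D) = let x∈C , x∈D = x∈p∩q⁻ C D x∈C∩D in apart x∈C x∈D

  apart : ∀ {C D : Subset n} → Disjoint C D → ∀ {x} → x ∈ C → x ∈ D → ⊥
  apart C∩D=∅ x∈C x∈D = C∩D=∅ (_ , x∈p∩q⁺ (x∈C , x∈D))

  Disjoint-⊆ : ∀ {C D C' D' : Subset n} → C' ⊆ C → D' ⊆ D → Disjoint C D → Disjoint C' D'
  Disjoint-⊆ C'⊆C D'⊆D C∩D=∅ = disjoint λ x∈C' x∈D' → apart C∩D=∅ (C'⊆C x∈C') (D'⊆D x∈D')

  Disjoint-sym : ∀ {C D : Subset n} → Disjoint C D → Disjoint D C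
  Disjoint-sym C∩D=∅ = disjoint λ x∈D x∈C → apart C∩D=∅ x∈C x∈D

  Disjoint-∪ˡ : ∀ {C C' D : Subset n} → Disjoint C D → Disjoint C' D → Disjoint (C ∪ C') D
  Disjoint-∪ˡ {C} {C'} C∩D=∅ C'∩D=∅ = disjoint λ x∈C∪C' x∈D →
    [ (λ x∈C → apart C∩D=∅ x∈C x∈D) , (λ x∈C' → apart C'∩D=∅ x∈C' x∈D) ]′ (x∈p∪q⁻ C C' x∈C∪C')

  Disjoint-∪ʳ : ∀ {C D D' : Subset n} → Disjoint C D → Disjoint C D' → Disjoint C (D ∪ D')
  Disjoint-∪ʳ C∩D=∅ C∩D'=∅ = Disjoint-sym (Disjoint-∪ˡ (Disjoint-sym C∩D=∅) (Disjoint-sym C∩D'=∅))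

  Disjoint-⁅⁆ˡ : ∀ {C : Subset n} {x} → x ∉ C → Disjoint ⁅ x ⁆ C
  Disjoint-⁅⁆ˡ {x = x} x∉C = disjoint λ y∈⁅x⁆ y∈C → x∉C (subst (_∈ _) (x∈⁅y⁆⇒x≡y x y∈⁅x⁆) y∈C)

  Disjoint-∩∁ : ∀ (C D : Subset n) → Disjoint (C ∩ ∁ D) D
  Disjoint-∩∁ C D = disjoint λ x∈C∩∁D → x∈∁p⇒x∉p (proj₂ (x∈p∩q⁻ C (∁ D) x∈C∩∁D))

  ⊆-∩∁ : ∀ {C D D' : Subset n} → C ⊆ D → Disjoint C D' → C ⊆ D ∩ ∁ D'
  ⊆-∩∁ C⊆D C∩D'=∅ = ⊆-∩ C⊆D (x∉p⇒x∈∁p ∘ apart C∩D'=∅)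

  termSep? : (T : List (Pair n)) (A B : Subset n) → Dec (TermSep T A B)
  termSep? T A B = ¬? (nonempty? (A ∩ B)) ×-dec map′ from-All to-All (All.all? placed? T)
    where
    Placed : Fin n → Fin n → Set
    Placed a b = (a ∈ A × b ∈ B) ⊎ (b ∈ A × a ∈ B) ⊎ (a ∉ A ∪ B × b ∉ A ∪ B)
    placed? : ∀ p → Dec (Placed (proj₁ p) (proj₂ p))
    placed? (a , b) = ((a ∈? A) ×-dec (b ∈? B)) ⊎-dec ((b ∈? A) ×-dec (a ∈? B)) ⊎-dec
                      (¬? (a ∈? (A ∪ B)) ×-dec ¬? (b ∈? (A ∪ B)))
    from-All : All.All (λ p → Placed (proj₁ p) (proj₂ p)) T → ∀ a b → (a , b) ∈L T → Placed a b
    from-All all a b p∈T = All.lookup all p∈T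
    to-All : (∀ a b → (a , b) ∈L T → Placed a b) → All.All (λ p → Placed (proj₁ p) (proj₂ p)) T
    to-All placed = All.tabulate λ {p} p∈T → placed (proj₁ p) (proj₂ p) p∈T

  maximal-fixpoint : ∀ {E : List (Edge n)} {T : List (Pair n)} {A B A' B' : Subset n} →
    Maximal E T A B → TermSep T A' B' → Extends A B A' B' → cost2 E A' B' ≤ cost2 E A B →
    A' ≡ A × B' ≡ B
  maximal-fixpoint {A = A} {B} {A'} {B'} (_ , maximal) sep ext cost≤
    with ≡-dec _≟ᵇ_ A' A ×-dec ≡-dec _≟ᵇ_ B' B
  ... | yes A'≡A,B'≡B = A'≡A,B'≡B
  ... | no  ≢        = contradiction cost≤ (<⇒≱ (maximal A' B' sep ext ≢))

pinched : ∀ {m u l : ℕ} → m ≤ u → m ≤ l → u + l ≤ m + m → u ≤ m × l ≤ m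
pinched {m} {u} {l} m≤u m≤l u+l≤m+m =
  +-cancelʳ-≤ l u m (≤-trans u+l≤m+m (+-monoʳ-≤ m m≤l)) ,
  +-cancelˡ-≤ u l m (≤-trans u+l≤m+m (+-monoˡ-≤ m m≤u))

any-pair? : ∀ {n} {Q : Pred (Subset n × Subset n) 0ℓ} → Decidable Q → Dec (∃ Q)
any-pair? Q? = map′ (λ (A , B , q) → (A , B) , q) (λ ((A , B) , q) → A , B , q)
  (anySubset? λ A → anySubset? λ B → Q? (A , B))

module _ {X : Set} (search : ∀ {Q : Pred X 0ℓ} → Decidable Q → Dec (∃ Q))
         {P : Pred X 0ℓ} (P? : Decidable P) where

  argmin : (f : X → ℕ) → ∃ P → ∃ λ x → P x × ∀ y → P y → f x ≤ f y
  argmin f (x , px) = descend x px (<-wellFounded (f x))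
    where
    descend : ∀ x → P x → Acc _<_ (f x) → ∃ λ x → P x × ∀ y → P y → f x ≤ f y
    descend x px (acc smaller) with search (λ y → P? y ×-dec (f y <? f x))
    ... | yes (y , py , fy<fx) = descend y py (smaller fy<fx)
    ... | no  ∄smaller = x , px , λ y py → ≮⇒≥ λ fy<fx → ∄smaller (y , py , fy<fx)

  argmax : (f : X → ℕ) {N : ℕ} → (∀ x → f x ≤ N) → ∃ P → ∃ λ x → P x × ∀ y → P y → f y ≤ f x
  argmax f {N} f≤N p with argmin (λ x → N ∸ f x) p
  ... | x , px , least = x , px , λ y py → ∸-cancelʳ-≤ (f≤N y) (least y py)

module Instance {n : ℕ} (E : List (Edge n)) (T : List (Pair n)) (A° B° : Subset n)
  (valid : ValidTerminals E T) (sep° : TermSep T A° B°) (s t : Fin n)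
  (st∈T : (s , t) ∈L T ⊎ (t , s) ∈L T) (st-unresolved : Unresolved A° B° (s , t))
  (resolves-only-st : ∀ A B → InF E T A° B° s t A B →
     ∀ p → p ∈L T → Unresolved A° B° p → ¬ SamePair p s t → ¬ Resolves A B p) where

  same-or-disjoint : ∀ {p q} → p ∈L T → q ∈L T → p ≡ q ⊎ DisjointPairs p q
  same-or-disjoint p∈T q∈T with Any.index p∈T ≟ᶠ Any.index q∈T
  ... | yes i≡j =
    inj₁ (trans (lookup-index p∈T) (trans (cong (lookupL T) i≡j) (sym (lookup-index q∈T))))
  ... | no  i≢j = inj₂ (subst₂ DisjointPairs (sym (lookup-index p∈T)) (sym (lookup-index q∈T))
                          (proj₁ (proj₂ valid) _ _ i≢j))

  s≢t : s ≢ t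
  s≢t = [ All.lookup (proj₁ valid) , (λ ts∈T → All.lookup (proj₁ valid) ts∈T ∘ sym) ]′ st∈T

  other-pair-avoids-s-t : ∀ {a b} → (a , b) ∈L T → ¬ SamePair (a , b) s t →
    (a ≢ s × a ≢ t) × (b ≢ s × b ≢ t)
  other-pair-avoids-s-t {a} {b} ab∈T ¬same = [ via-st , via-ts ]′ st∈T
    where
    via-st : (s , t) ∈L T → (a ≢ s × a ≢ t) × (b ≢ s × b ≢ t)
    via-st st∈T with same-or-disjoint ab∈T st∈T
    ... | inj₁ refl                    = contradiction (inj₁ (refl , refl)) ¬same
    ... | inj₂ (a≢s , a≢t , b≢s , b≢t) = (a≢s , a≢t) , (b≢s , b≢t)
    via-ts : (t , s) ∈L T → (a ≢ s × a ≢ t) × (b ≢ s × b ≢ t)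
    via-ts ts∈T with same-or-disjoint ab∈T ts∈T
    ... | inj₁ refl                    = contradiction (inj₂ (refl , refl)) ¬same
    ... | inj₂ (a≢t , a≢s , b≢t , b≢s) = (a≢s , a≢t) , (b≢s , b≢t)

  Avoids : Subset n → Set
  Avoids C = ∀ a b → (a , b) ∈L T → Unresolved A° B° (a , b) → ¬ SamePair (a , b) s t →
    a ∉ C × b ∉ C

  Avoids-∪ : ∀ {C D} → Avoids C → Avoids D → Avoids (C ∪ D)
  Avoids-∪ avoidsC avoidsD a b ab∈T unresolved ¬same =
    let a∉C , b∉C = avoidsC a b ab∈T unresolved ¬same
        a∉D , b∉D = avoidsD a b ab∈T unresolved ¬same
    in ∉-∪ a∉C a∉D , ∉-∪ b∉C b∉D

  Avoids-⊆ : ∀ {C D} → C ⊆ D → Avoids D → Avoids C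
  Avoids-⊆ C⊆D avoidsD a b ab∈T unresolved ¬same =
    let a∉D , b∉D = avoidsD a b ab∈T unresolved ¬same in a∉D ∘ C⊆D , b∉D ∘ C⊆D

  avoids-of-¬resolves : ∀ {C D} → TermSep T C D →
    (∀ p → p ∈L T → Unresolved A° B° p → ¬ SamePair p s t → ¬ Resolves C D p) →
    Avoids (C ∪ D)
  avoids-of-¬resolves (_ , placed) ¬resolves a b ab∈T unresolved ¬same with placed a b ab∈T
  ... | inj₁ (a∈C , b∈D) =
    contradiction (x∈p∪q⁺ (inj₁ a∈C) , x∈p∪q⁺ (inj₂ b∈D)) (¬resolves _ ab∈T unresolved ¬same)
  ... | inj₂ (inj₁ (b∈C , a∈D)) =
    contradiction (x∈p∪q⁺ (inj₂ a∈D) , x∈p∪q⁺ (inj₁ b∈C)) (¬resolves _ ab∈T unresolved ¬same)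
  ... | inj₂ (inj₂ a,b∉C∪D) = a,b∉C∪D

  Base₁ Base₂ : Subset n
  Base₁ = A° ∪ ⁅ s ⁆
  Base₂ = B° ∪ ⁅ t ⁆

  s∈Base₁ : s ∈ Base₁
  s∈Base₁ = x∈p∪q⁺ (inj₂ (x∈⁅x⁆ s))

  t∈Base₂ : t ∈ Base₂
  t∈Base₂ = x∈p∪q⁺ (inj₂ (x∈⁅x⁆ t))

  Extension : Subset n × Subset n → Set
  Extension (A , B) = TermSep T A B × Extends Base₁ Base₂ A B

  extension? : Decidable Extension
  extension? (A , B) = termSep? T A B ×-dec ((Base₁ ⊆? A) ×-dec (Base₂ ⊆? B))

  extension : ∀ {C D} → Base₁ ⊆ C → Base₂ ⊆ D → Disjoint C D → Avoids C → Avoids D →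
    Extension (C , D)
  extension {C} {D} Base₁⊆C Base₂⊆D C∩D=∅ avoidsC avoidsD = (C∩D=∅ , placed) , Base₁⊆C , Base₂⊆D
    where
    placed : ∀ a b → (a , b) ∈L T → (a ∈ C × b ∈ D) ⊎ (b ∈ C × a ∈ D) ⊎ (a ∉ C ∪ D × b ∉ C ∪ D)
    placed a b ab∈T with proj₂ sep° a b ab∈T
    ... | inj₁ (a∈A° , b∈B°) =
      inj₁ (Base₁⊆C (p⊆p∪q ⁅ s ⁆ a∈A°) , Base₂⊆D (p⊆p∪q ⁅ t ⁆ b∈B°))
    ... | inj₂ (inj₁ (b∈A° , a∈B°)) =
      inj₂ (inj₁ (Base₁⊆C (p⊆p∪q ⁅ s ⁆ b∈A°) , Base₂⊆D (p⊆p∪q ⁅ t ⁆ a∈B°)))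
    ... | inj₂ (inj₂ unresolved) with (a ≟ᶠ s ×-dec b ≟ᶠ t) ⊎-dec (a ≟ᶠ t ×-dec b ≟ᶠ s)
    ...   | yes (inj₁ (refl , refl)) = inj₁ (Base₁⊆C s∈Base₁ , Base₂⊆D t∈Base₂)
    ...   | yes (inj₂ (refl , refl)) = inj₂ (inj₁ (Base₁⊆C s∈Base₁ , Base₂⊆D t∈Base₂))
    ...   | no  ¬same =
      let a∉C , b∉C = avoidsC a b ab∈T unresolved ¬same
          a∉D , b∉D = avoidsD a b ab∈T unresolved ¬same
      in inj₂ (inj₂ (∉-∪ a∉C a∉D , ∉-∪ b∉C b∉D))

  base-extension : Extension (Base₁ , Base₂)
  base-extension = extension id id Base₁∩Base₂=∅ avoids-Base₁ avoids-Base₂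
    where
    Base₁∩Base₂=∅ : Disjoint Base₁ Base₂
    Base₁∩Base₂=∅ = Disjoint-∪ˡ
      (Disjoint-∪ʳ (proj₁ sep°) (Disjoint-sym (Disjoint-⁅⁆ˡ (proj₂ st-unresolved ∘ p⊆p∪q B°))))
      (Disjoint-∪ʳ (Disjoint-⁅⁆ˡ (proj₁ st-unresolved ∘ q⊆p∪q A° B°))
                   (Disjoint-⁅⁆ˡ (s≢t ∘ x∈⁅y⁆⇒x≡y t)))
    ∉-Base : ∀ {X : Subset n} {x} u → X ⊆ A° ∪ B° → x ∉ A° ∪ B° → x ≢ u → x ∉ X ∪ ⁅ u ⁆
    ∉-Base u X⊆A°∪B° x∉A°∪B° x≢u = ∉-∪ (x∉A°∪B° ∘ X⊆A°∪B°) (x≢u ∘ x∈⁅y⁆⇒x≡y u)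
    avoids-Base₁ : Avoids Base₁
    avoids-Base₁ a b ab∈T (a∉A°∪B° , b∉A°∪B°) ¬same =
      let (a≢s , _) , (b≢s , _) = other-pair-avoids-s-t ab∈T ¬same
      in ∉-Base s (p⊆p∪q B°) a∉A°∪B° a≢s , ∉-Base s (p⊆p∪q B°) b∉A°∪B° b≢s
    avoids-Base₂ : Avoids Base₂
    avoids-Base₂ a b ab∈T (a∉A°∪B° , b∉A°∪B°) ¬same =
      let (_ , a≢t) , (_ , b≢t) = other-pair-avoids-s-t ab∈T ¬same
      in ∉-Base t (q⊆p∪q A° B°) a∉A°∪B° a≢t , ∉-Base t (q⊆p∪q A° B°) b∉A°∪B° b≢t

  cost : Subset n × Subset n → ℕ
  cost (A , B) = cost2 E A B

  -- Kept abstract, like champion: unfolding the exhaustive searches during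
  -- typechecking is prohibitively slow.
  abstract
   cheapest : ∃ λ y → Extension y × ∀ y' → Extension y' → cost y ≤ cost y'
   cheapest = argmin any-pair? extension? cost (_ , base-extension)

  μ : ℕ
  μ = cost (proj₁ cheapest)

  μ-least : ∀ y → Extension y → μ ≤ cost y
  μ-least = proj₂ (proj₂ cheapest)

  Optimal : Subset n × Subset n → Set
  Optimal y = Extension y × cost y ≤ μ

  optimal? : Decidable Optimal
  optimal? y = extension? y ×-dec (cost y ≤? μ)

  InF⇒Optimal : ∀ {A B} → InF E T A° B° s t A B → Optimal (A , B)
  InF⇒Optimal ((sep , _) , ext , least) =
    (sep , ext) , least _ _ (proj₁ (proj₁ (proj₂ cheapest))) (proj₂ (proj₁ (proj₂ cheapest)))

  Optimal∧Maximal⇒InF : ∀ {A B} → Optimal (A , B) → Maximal E T A B → InF E T A° B° s t A B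
  Optimal∧Maximal⇒InF ((_ , ext) , cost≤μ) maximal =
    maximal , ext , λ A' B' sep' ext' → ≤-trans cost≤μ (μ-least _ (sep' , ext'))

  record Champion : Set where
    field
      P Q     : Subset n
      optimal : Optimal (P , Q)
      maximal : Maximal E T P Q
      largest : ∀ A B → Optimal (A , B) → ∣ A ∣ ≤ ∣ P ∣

  champion-of : ∀ {P₀} → (∀ A B → Optimal (A , B) → ∣ A ∣ ≤ ∣ P₀ ∣) →
    (∃ λ y → (Optimal y × P₀ ⊆ proj₁ y) ×
             ∀ y' → Optimal y' × P₀ ⊆ proj₁ y' → ∣ proj₂ y' ∣ ≤ ∣ proj₂ y ∣) →
    Champion
  champion-of largest₀ ((P , Q) , (optimal , P₀⊆P) , largest-Q) = record
    { P = P ; Q = Q ; optimal = optimal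
    ; maximal = proj₁ (proj₁ optimal) , maximal ; largest = largest }
    where
    largest : ∀ A B → Optimal (A , B) → ∣ A ∣ ≤ ∣ P ∣
    largest A B opt = ≤-trans (largest₀ A B opt) (p⊆q⇒∣p∣≤∣q∣ P₀⊆P)
    maximal : ∀ A' B' → TermSep T A' B' → Extends P Q A' B' → ¬ (A' ≡ P × B' ≡ Q) →
      cost2 E P Q < cost2 E A' B'
    maximal A' B' sep' (P⊆A' , Q⊆B') ≢ = ≰⇒> λ cost'≤ →
      let opt' : Optimal (A' , B')
          opt' = ( sep'
                 , P⊆A' ∘ proj₁ (proj₂ (proj₁ optimal)) , Q⊆B' ∘ proj₂ (proj₂ (proj₁ optimal)))
               , ≤-trans cost'≤ (proj₂ optimal)
      in ≢ ( sym (p⊆q∧∣q∣≤∣p∣⇒p≡q P⊆A' (largest A' B' opt'))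
           , sym (p⊆q∧∣q∣≤∣p∣⇒p≡q Q⊆B' (largest-Q (A' , B') (opt' , P⊆A' ∘ P₀⊆P))))

  -- First maximise ∣ A ∣ over the optimal separations, then ∣ B ∣ over those whose
  -- first side contains the first maximiser.
  abstract
   champion : Champion
   champion =
     let (P₀ , _) , optimal₀ , largest₀ =
           argmax any-pair? optimal? (∣_∣ ∘ proj₁) (∣p∣≤n ∘ proj₁)
             (_ , proj₁ (proj₂ cheapest) , ≤-refl)
     in champion-of (λ A B → largest₀ (A , B))
          (argmax any-pair? (λ y → optimal? y ×-dec (P₀ ⊆? proj₁ y)) (∣_∣ ∘ proj₂) (∣p∣≤n ∘ proj₂)
            (_ , optimal₀ , id))

  open Champion champion public

  avoids-InF : ∀ {A B} → InF E T A° B° s t A B → Avoids A × Avoids B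
  avoids-InF {A} {B} inF = Avoids-⊆ (p⊆p∪q B) avoids-A∪B , Avoids-⊆ (q⊆p∪q A B) avoids-A∪B
    where
    avoids-A∪B : Avoids (A ∪ B)
    avoids-A∪B = avoids-of-¬resolves (proj₁ (proj₁ inF)) (resolves-only-st _ _ inF)

  champion-InF : InF E T A° B° s t P Q
  champion-InF = Optimal∧Maximal⇒InF optimal maximal

  P∩Q=∅ : Disjoint P Q
  P∩Q=∅ = proj₁ (proj₁ (proj₁ optimal))

  Base₁⊆P : Base₁ ⊆ P
  Base₁⊆P = proj₁ (proj₂ (proj₁ optimal))

  Base₂⊆Q : Base₂ ⊆ Q
  Base₂⊆Q = proj₂ (proj₂ (proj₁ optimal))

  avoids-P : Avoids P
  avoids-P = proj₁ (avoids-InF champion-InF)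

  avoids-Q : Avoids Q
  avoids-Q = proj₂ (avoids-InF champion-InF)

  InF⇒⊆champion : ∀ A B → InF E T A° B° s t A B → A ⊆ P × Q ⊆ B
  InF⇒⊆champion A B inF = A⊆P , Q⊆B
    where
    opt : Optimal (A , B)
    opt = InF⇒Optimal inF
    A∩B=∅ : Disjoint A B
    A∩B=∅ = proj₁ (proj₁ (proj₁ opt))
    join : Extension (P ∪ A , Q ∩ B)
    join = extension (p⊆p∪q A ∘ Base₁⊆P) (⊆-∩ Base₂⊆Q (proj₂ (proj₂ (proj₁ opt))))
             (Disjoint-∪ˡ (Disjoint-⊆ id (p∩q⊆p Q B) P∩Q=∅) (Disjoint-⊆ id (p∩q⊆q Q B) A∩B=∅))
             (Avoids-∪ avoids-P (proj₁ (avoids-InF inF))) (Avoids-⊆ (p∩q⊆p Q B) avoids-Q)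
    meet : Extension (P ∩ A , Q ∪ B)
    meet = extension (⊆-∩ Base₁⊆P (proj₁ (proj₂ (proj₁ opt)))) (p⊆p∪q B ∘ Base₂⊆Q)
             (Disjoint-∪ʳ (Disjoint-⊆ (p∩q⊆p P A) id P∩Q=∅) (Disjoint-⊆ (p∩q⊆q P A) id A∩B=∅))
             (Avoids-⊆ (p∩q⊆p P A) avoids-P) (Avoids-∪ avoids-Q (proj₂ (avoids-InF inF)))
    both-optimal : cost (P ∪ A , Q ∩ B) ≤ μ × cost (P ∩ A , Q ∪ B) ≤ μ
    both-optimal = pinched (μ-least _ join) (μ-least _ meet)
      (≤-trans (cost2-submodular E P Q A B) (+-mono-≤ (proj₂ optimal) (proj₂ opt)))
    A⊆P : A ⊆ P
    A⊆P = ∣p∪q∣≤∣p∣⇒q⊆p (largest (P ∪ A) (Q ∩ B) (join , proj₁ both-optimal))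
    Q∪B≡B : Q ∪ B ≡ B
    Q∪B≡B = proj₂ (maximal-fixpoint {E = E} (proj₁ inF) (proj₁ meet)
      (⊆-∩ A⊆P id , q⊆p∪q Q B)
      (≤-trans (proj₂ both-optimal) (μ-least _ (proj₁ opt))))
    Q⊆B : Q ⊆ B
    Q⊆B x∈Q = subst (_ ∈_) Q∪B≡B (p⊆p∪q B x∈Q)

  champion-unique : ∀ A' B' → InF E T A° B° s t A' B' →
    (∀ A B → InF E T A° B° s t A B → A ⊆ A' × B' ⊆ B) → A' ≡ P × B' ≡ Q
  champion-unique A' B' inF' below =
    let P⊆A' , B'⊆Q = below P Q champion-InF
        A'⊆P , Q⊆B' = InF⇒⊆champion A' B' inF'
    in ⊆-antisym A'⊆P P⊆A' , ⊆-antisym B'⊆Q Q⊆B'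

  d-P≤ : ∀ {C} → Extension (C , Q) → d E P ≤ d E C
  d-P≤ ext = +-cancelʳ-≤ (d E Q) _ _ (≤-trans (proj₂ optimal) (μ-least _ ext))

  -- If d A ≤ d P then (P ∪ A , Q ∖ (P ∪ A)) is optimal, by submodularity against
  -- (P ∩ A , Q) and posimodularity against (P ∪ A ∖ Q , Q); but P ∪ A is larger than P.
  d-P-minimal : ∀ (A : Subset n) → Base₁ ⊆ A → Disjoint A B° →
    (∀ a b → (a , b) ∈L T → Unresolved A° B° (a , b) → (a ≢ s → a ∉ A) × (b ≢ s → b ∉ A)) →
    (∃ λ v → v ∈ A × v ∉ P) → d E P < d E A
  d-P-minimal A Base₁⊆A A∩B°=∅ only-s (v , v∈A , v∉P) = ≰⇒> λ dA≤dP →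
    <⇒≱ (p⊂q⇒∣p∣<∣q∣ (p⊆p∪q A , v , q⊆p∪q P A v∈A , v∉P))
        (largest X (Q ∩ ∁ X)
          (outer , ≤-trans (+-mono-≤ (dX≤dP dA≤dP) (dQ∖X≤dQ dA≤dP)) (proj₂ optimal)))
    where
    X : Subset n
    X = P ∪ A
    avoids-A : Avoids A
    avoids-A a b ab∈T unresolved ¬same =
      let (a≢s , _) , (b≢s , _) = other-pair-avoids-s-t ab∈T ¬same
      in proj₁ (only-s a b ab∈T unresolved) a≢s , proj₂ (only-s a b ab∈T unresolved) b≢s
    avoids-X : Avoids X
    avoids-X = Avoids-∪ avoids-P avoids-A
    t∉A : t ∉ A
    t∉A = [ (λ st∈T → proj₂ (only-s s t st∈T st-unresolved) (s≢t ∘ sym))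
          , (λ ts∈T → proj₁ (only-s t s ts∈T (swap st-unresolved)) (s≢t ∘ sym))
          ]′ st∈T
    Base₂∩A=∅ : Disjoint Base₂ A
    Base₂∩A=∅ = Disjoint-∪ˡ (Disjoint-sym A∩B°=∅) (Disjoint-⁅⁆ˡ t∉A)
    Base₂∩X=∅ : Disjoint Base₂ X
    Base₂∩X=∅ = Disjoint-∪ʳ (Disjoint-⊆ Base₂⊆Q id (Disjoint-sym P∩Q=∅)) Base₂∩A=∅
    inner : Extension (P ∩ A , Q)
    inner = extension (⊆-∩ Base₁⊆P Base₁⊆A) Base₂⊆Q
              (Disjoint-⊆ (p∩q⊆p P A) id P∩Q=∅) (Avoids-⊆ (p∩q⊆p P A) avoids-P) avoids-Q
    trimmed : Extension (X ∩ ∁ Q , Q)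
    trimmed = extension (⊆-∩∁ (p⊆p∪q A ∘ Base₁⊆P) (Disjoint-⊆ Base₁⊆P id P∩Q=∅)) Base₂⊆Q
      (Disjoint-∩∁ X Q) (Avoids-⊆ (p∩q⊆p X (∁ Q)) avoids-X) avoids-Q
    outer : Extension (X , Q ∩ ∁ X)
    outer = extension (p⊆p∪q A ∘ Base₁⊆P) (⊆-∩∁ Base₂⊆Q Base₂∩X=∅)
      (Disjoint-sym (Disjoint-∩∁ Q X)) avoids-X (Avoids-⊆ (p∩q⊆p Q (∁ X)) avoids-Q)
    dX≤dP : d E A ≤ d E P → d E X ≤ d E P
    dX≤dP dA≤dP = +-cancelʳ-≤ (d E P) _ _ (begin
      d E X + d E P        ≤⟨ +-monoʳ-≤ (d E X) (d-P≤ inner) ⟩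
      d E X + d E (P ∩ A)  ≤⟨ d-submodular E P A ⟩
      d E P + d E A        ≤⟨ +-monoʳ-≤ (d E P) dA≤dP ⟩
      d E P + d E P        ∎)
      where open ≤-Reasoning
    dQ∖X≤dQ : d E A ≤ d E P → d E (Q ∩ ∁ X) ≤ d E Q
    dQ∖X≤dQ dA≤dP = +-cancelˡ-≤ (d E P) _ _ (begin
      d E P + d E (Q ∩ ∁ X)          ≤⟨ +-monoˡ-≤ (d E (Q ∩ ∁ X)) (d-P≤ trimmed) ⟩
      d E (X ∩ ∁ Q) + d E (Q ∩ ∁ X)  ≤⟨ d-posimodular E X Q ⟩
      d E X + d E Q                  ≤⟨ +-monoˡ-≤ (d E Q) (dX≤dP dA≤dP) ⟩
      d E P + d E Q                  ∎)
      where open ≤-Reasoning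

lemma5p4 : (n : ℕ) (E : List (Edge n)) (T : List (Pair n)) (A° B° : Subset n) (k : ℤ) →
    LoopFree E → ValidTerminals E T → TermSep T A° B° →
    (s t : Fin n) → ((s , t) ∈L T ⊎ (t , s) ∈L T) → Unresolved A° B° (s , t) →
    (∀ A B → InF E T A° B° s t A B →
      ∀ p → p ∈L T → Unresolved A° B° p → ¬ SamePair p s t → ¬ Resolves A B p) →
    Σ (Subset n) λ Amax → Σ (Subset n) λ Bmin →
      (InF E T A° B° s t Amax Bmin
      × (∀ A B → InF E T A° B° s t A B → A ⊆ Amax × Bmin ⊆ B)
      × (∀ A' B' → InF E T A° B° s t A' B' →
           (∀ A B → InF E T A° B° s t A B → A ⊆ A' × B' ⊆ B) →
           A' ≡ Amax × B' ≡ Bmin))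
      × (∀ (A : Subset n) → (A° ∪ ⁅ s ⁆) ⊆ A → Disjoint A B° →
           (∀ a b → (a , b) ∈L T → Unresolved A° B° (a , b) →
              (a ≢ s → a ∉ A) × (b ≢ s → b ∉ A)) →
           (∃ λ v → v ∈ A × v ∉ Amax) →
           d E Amax < d E A)
lemma5p4 n E T A° B° _ _ valid sep° s t st∈T st-unresolved resolves-only-st =
  P , Q , (champion-InF , InF⇒⊆champion , champion-unique) , d-P-minimal
  where open Instance E T A° B° valid sep° s t st∈T st-unresolved resolves-only-st
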